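{- Let $\langle A,\succ,1\rangle$ be a bounded G-algebra with least element $0$, let $\leq$ be the order $x\leq y \iff x\succ y=1$, let $x\vee y=(x\succ y)\succ y$, and let $\sim x=x\succ 0$. Then for all $x,y,z\in A$: (G19) $\sim\sim x=x$; (G20) if $x\leq y$ then $\sim y\leq\ \sim x$; (G21) $\sim(\sim x\vee\sim y)\leq x$; (G22) $\sim(\sim x\vee\sim y)\leq y$; (G23) if $z\leq x$ and $z\leq y$ then $z\leq\ \sim(\sim x\vee\sim y)$; (G24) $(A,\leq)$ is a meet semilattice in which the infimum of $x,y$ is $x\wedge y=\sim(\sim x\vee\sim y)=(((x\succ 0)\succ(y\succ 0))\succ(y\succ 0))\succ 0$; (G25) $\sim(x\vee y)=\sim x\wedge\sim y$; (G26) $\sim(x\wedge y)=\sim x\vee\sim y$; (G27) $(x\succ z)\vee(y\succ z)\leq (x\wedge y)\succ z$.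
   Context: A G-algebra is an algebra $\langle A,\succ,1\rangle$ of type $(2,0)$ satisfying for all $x,y,z$: (G1) $1\succ x=x$; (G2) $x\succ 1=1$; (G3) $(x\succ y)\succ y=(y\succ x)\succ x$; (G4) if $x\succ(y\succ z)=1$ then $y\succ(x\succ z)=1$. In a G-algebra, $x\leq y$ iff $x\succ y=1$ is a partial order and $x\vee y=(x\succ y)\succ y$ is the supremum. A G-algebra is bounded (a ${\rm G}^0$-algebra) if there is $0\in A$ with $0\leq x$ for all $x\in A$. -}

module Defs where

open import Level using (Level; suc)
open import Relation.Binary.PropositionalEquality using (_≡_)

record IsGAlgebra {a : Level} {A : Set a} (_≻_ : A → A → A) (𝟏 : A) : Set a where
  field
    G1 : ∀ x → 𝟏 ≻ x ≡ x
    G2 : ∀ x → x ≻ 𝟏 ≡ 𝟏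
    G3 : ∀ x y → (x ≻ y) ≻ y ≡ (y ≻ x) ≻ x
    G4 : ∀ x y z → x ≻ (y ≻ z) ≡ 𝟏 → y ≻ (x ≻ z) ≡ 𝟏

record IsBoundedGAlgebra {a : Level} {A : Set a} (_≻_ : A → A → A) (𝟏 𝟎 : A) : Set a where
  field
    isGAlgebra : IsGAlgebra _≻_ 𝟏
    least      : ∀ x → 𝟎 ≻ x ≡ 𝟏
  open IsGAlgebra isGAlgebra public

module GOps {a : Level} {A : Set a} (_≻_ : A → A → A) (𝟏 𝟎 : A) where
  _≤_ : A → A → Set a
  x ≤ y = x ≻ y ≡ 𝟏

  _∨_ : A → A → A
  x ∨ y = (x ≻ y) ≻ y

  ∼_ : A → A
  ∼ x = x ≻ 𝟎

  _∧_ : A → A → A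
  x ∧ y = ∼ ((∼ x) ∨ (∼ y))

  infix 4 _≤_
  infixr 7 _∧_
  infixr 6 _∨_
  infix 8 ∼_

-- In a G-algebra, ≤ is a partial order in which x ∨ y is the join, and the exchange
-- law G4 makes x ↦ x ≻ z antitone. With a bottom element, ∼ ∼ x = x ∨ 0 = x, so ∼ is
-- an order-reversing involution; it therefore carries the join ∨ to a meet ∧, and the
-- De Morgan laws and G27 follow.
module Submission where

open import Defs
open import Level using (Level)
open import Data.Product using (_×_; _,_)
open import Relation.Binary.PropositionalEquality
  using (_≡_; refl; sym; trans; cong; cong₂; subst; isEquivalence; module ≡-Reasoning)
open import Relation.Binary.Structures using (IsPartialOrder)
open import Relation.Binary.Lattice.Structures using (IsMeetSemilattice)

module GAlgebraProperties {a : Level} {A : Set a} (_≻_ : A → A → A) (𝟏 : A)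
                          (G : IsGAlgebra _≻_ 𝟏) where
  open IsGAlgebra G
  -- _≤_ and _∨_ do not depend on the bottom argument of GOps.
  open GOps _≻_ 𝟏 𝟏 using (_≤_; _∨_)
  open ≡-Reasoning

  ≤-refl : ∀ x → x ≤ x
  ≤-refl x = begin
    x ≻ x        ≡⟨ cong (_≻ x) (sym (G1 x)) ⟩
    (𝟏 ≻ x) ≻ x  ≡⟨ G3 𝟏 x ⟩
    (x ≻ 𝟏) ≻ 𝟏  ≡⟨ G2 (x ≻ 𝟏) ⟩
    𝟏            ∎

  ∨-comm : ∀ x y → x ∨ y ≡ y ∨ x
  ∨-comm = G3

  y≤x⇒x∨y≡x : ∀ {x y} → y ≤ x → x ∨ y ≡ x
  y≤x⇒x∨y≡x {x} {y} y≤x = begin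
    (x ≻ y) ≻ y  ≡⟨ G3 x y ⟩
    (y ≻ x) ≻ x  ≡⟨ cong (_≻ x) y≤x ⟩
    𝟏 ≻ x        ≡⟨ G1 x ⟩
    x            ∎

  ≤-antisym : ∀ {x y} → x ≤ y → y ≤ x → x ≡ y
  ≤-antisym {x} {y} x≤y y≤x = begin
    x            ≡⟨ sym (y≤x⇒x∨y≡x y≤x) ⟩
    (x ≻ y) ≻ y  ≡⟨ cong (_≻ y) x≤y ⟩
    𝟏 ≻ y        ≡⟨ G1 y ⟩
    y            ∎

  x≤x∨y : ∀ x y → x ≤ x ∨ y
  x≤x∨y x y = G4 (x ≻ y) x y (≤-refl (x ≻ y))

  y≤x∨y : ∀ x y → y ≤ x ∨ y
  y≤x∨y x y = subst (y ≤_) (∨-comm y x) (x≤x∨y y x)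

  -- Since z = z ∨ y, it suffices that x ≤ (z ≻ y) ≻ y, which G4 reduces to x ≤ y.
  ≤-trans : ∀ {x y z} → x ≤ y → y ≤ z → x ≤ z
  ≤-trans {x} {y} {z} x≤y y≤z = subst (x ≤_) (y≤x⇒x∨y≡x y≤z)
    (G4 (z ≻ y) x y (trans (cong ((z ≻ y) ≻_) x≤y) (G2 (z ≻ y))))

  ≻-antitoneˡ : ∀ z {x y} → x ≤ y → y ≻ z ≤ x ≻ z
  ≻-antitoneˡ z {x} {y} x≤y = G4 x (y ≻ z) z (≤-trans x≤y (x≤x∨y y z))

  ∨-least : ∀ {x y z} → x ≤ z → y ≤ z → x ∨ y ≤ z
  ∨-least {x} {y} {z} x≤z y≤z = subst (x ∨ y ≤_) (y≤x⇒x∨y≡x y≤z)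
    (≻-antitoneˡ y (≻-antitoneˡ y x≤z))

  isPartialOrder : IsPartialOrder _≡_ _≤_
  isPartialOrder = record
    { isPreorder = record
      { isEquivalence = isEquivalence
      ; reflexive     = λ { {x} refl → ≤-refl x }
      ; trans         = ≤-trans
      }
    ; antisym = ≤-antisym
    }

module BoundedGAlgebraProperties {a : Level} {A : Set a} (_≻_ : A → A → A) (𝟏 𝟎 : A)
                                 (B : IsBoundedGAlgebra _≻_ 𝟏 𝟎) where
  open IsBoundedGAlgebra B
  open GOps _≻_ 𝟏 𝟎
  open GAlgebraProperties _≻_ 𝟏 isGAlgebra

  ∼-involutive : ∀ x → ∼ ∼ x ≡ x
  ∼-involutive x = y≤x⇒x∨y≡x (least x)

  ∼-antitone : ∀ {x y} → x ≤ y → ∼ y ≤ ∼ x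
  ∼-antitone = ≻-antitoneˡ 𝟎

  x≤∼y⇒y≤∼x : ∀ {x y} → x ≤ ∼ y → y ≤ ∼ x
  x≤∼y⇒y≤∼x {x} {y} = G4 x y 𝟎

  ∼x≤y⇒∼y≤x : ∀ {x y} → ∼ x ≤ y → ∼ y ≤ x
  ∼x≤y⇒∼y≤x {x} {y} ∼x≤y = subst (∼ y ≤_) (∼-involutive x) (∼-antitone ∼x≤y)

  x∧y≤x : ∀ x y → x ∧ y ≤ x
  x∧y≤x x y = ∼x≤y⇒∼y≤x (x≤x∨y (∼ x) (∼ y))

  x∧y≤y : ∀ x y → x ∧ y ≤ y
  x∧y≤y x y = ∼x≤y⇒∼y≤x (y≤x∨y (∼ x) (∼ y))

  ∧-greatest : ∀ {x y z} → z ≤ x → z ≤ y → z ≤ x ∧ y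
  ∧-greatest z≤x z≤y = x≤∼y⇒y≤∼x (∨-least (∼-antitone z≤x) (∼-antitone z≤y))

  isMeetSemilattice : IsMeetSemilattice _≡_ _≤_ _∧_
  isMeetSemilattice = record
    { isPartialOrder = isPartialOrder
    ; infimum        = λ x y → x∧y≤x x y , x∧y≤y x y , λ z → ∧-greatest
    }

  ∼-∨ : ∀ x y → ∼ (x ∨ y) ≡ ∼ x ∧ ∼ y
  ∼-∨ x y = sym (cong₂ (λ u v → ∼ (u ∨ v)) (∼-involutive x) (∼-involutive y))

  ∼-∧ : ∀ x y → ∼ (x ∧ y) ≡ ∼ x ∨ ∼ y
  ∼-∧ x y = ∼-involutive (∼ x ∨ ∼ y)

  x≻z∨y≻z≤x∧y≻z : ∀ x y z → (x ≻ z) ∨ (y ≻ z) ≤ (x ∧ y) ≻ z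
  x≻z∨y≻z≤x∧y≻z x y z = ∨-least (≻-antitoneˡ z (x∧y≤x x y)) (≻-antitoneˡ z (x∧y≤y x y))

lemma2p5 : {a : Level} {A : Set a} (_≻_ : A → A → A) (𝟏 𝟎 : A) → IsBoundedGAlgebra _≻_ 𝟏 𝟎 →
    let open GOps _≻_ 𝟏 𝟎 in
      (∀ x → ∼ ∼ x ≡ x)
      × (∀ x y → x ≤ y → ∼ y ≤ ∼ x)
      × (∀ x y → ∼ (∼ x ∨ ∼ y) ≤ x)
      × (∀ x y → ∼ (∼ x ∨ ∼ y) ≤ y)
      × (∀ x y z → z ≤ x → z ≤ y → z ≤ ∼ (∼ x ∨ ∼ y))
      × (IsMeetSemilattice _≡_ _≤_ _∧_
         × (∀ x y → x ∧ y ≡ (((x ≻ 𝟎) ≻ (y ≻ 𝟎)) ≻ (y ≻ 𝟎)) ≻ 𝟎))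
      × (∀ x y → ∼ (x ∨ y) ≡ ∼ x ∧ ∼ y)
      × (∀ x y → ∼ (x ∧ y) ≡ ∼ x ∨ ∼ y)
      × (∀ x y z → (x ≻ z) ∨ (y ≻ z) ≤ (x ∧ y) ≻ z)
lemma2p5 _≻_ 𝟏 𝟎 B =
  ∼-involutive , (λ _ _ → ∼-antitone) , x∧y≤x , x∧y≤y , (λ _ _ _ → ∧-greatest) ,
  (isMeetSemilattice , λ _ _ → refl) , ∼-∨ , ∼-∧ , x≻z∨y≻z≤x∧y≻z
  where open BoundedGAlgebraProperties _≻_ 𝟏 𝟎 B
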